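{- Let $\mathcal L$ be any language and let $D_0,D_1,\ldots$ be finite topological $\mathcal L$-structures. Suppose that for all $n\le m$ there is exactly one epimorphism $\pi_n^m:D_m\to D_n$. Then $(D_n,\pi_n^{n+1})_{n\in\mathbb N}$ is a fundamental sequence for the class $\{D_n\mid n\in\mathbb N\}$.
   Context: A topological $\mathcal L$-structure is a zero-dimensional, compact, Hausdorff, second countable space which is also an $\mathcal L$-structure, with relation symbols interpreted as closed sets and function symbols as continuous functions. An epimorphism between topological $\mathcal L$-structures $A,B$ is a continuous surjection $\varphi:A\to B$ such that $r^B=(\varphi\times\cdots\times\varphi)(r^A)$ for every relation symbol $r$, $f^B(\varphi(a_1),\ldots,\varphi(a_n))=\varphi(f^A(a_1,\ldots,a_n))$ for every $n$-ary function symbol $f$, and $\varphi(c^A)=c^B$ for every constant symbol $c$. If $\mathcal F$ is a class of topological $\mathcal L$-structures, a fundamental sequence $(D_n,\pi_n)$ for $\mathcal F$ is a sequence of elements $D_n\in\mathcal F$ with epimorphisms $\pi_n:D_{n+1}\to D_n$ such that, writing $\pi_n^m=\pi_n\circ\pi_{n+1}\circ\cdots\circ\pi_{m-1}:D_m\to D_n$ for $n<m$ and $\pi_n^n=\mathrm{id}_{D_n}$: (i) for every $D\in\mathcal F$ there are $n$ and an epimorphism $D_n\to D$; (ii) for every $n$, all $E,F\in\mathcal F$ and all epimorphisms $\varphi_1:F\to E$, $\varphi_2:D_n\to E$, there are $m\ge n$ and an epimorphism $\psi:D_m\to F$ with $\varphi_1\psi=\varphi_2\pi_n^m$. -}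

module Defs where

open import Data.Nat using (ℕ; zero; suc; _+_; _≤_)
open import Data.Fin using (Fin)
open import Data.Vec using (Vec)
import Data.Vec as Vec
open import Data.Product using (Σ; _×_; _,_; ∃)
open import Relation.Binary.PropositionalEquality using (_≡_)

record Language : Set₁ where
  field
    RelSym   : Set
    relAr    : RelSym → ℕ
    FunSym   : Set
    funAr    : FunSym → ℕ
    ConstSym : Set

-- A finite zero-dimensional compact
-- Hausdorff second countable space is a finite discrete space, so every
-- subset is closed and every function is continuous; the carrier is Fin size.
record FinStructure (L : Language) : Set₁ where
  open Language L
  field
    size  : ℕ
    relI  : (r : RelSym) → Vec (Fin size) (relAr r) → Set
    funI  : (f : FunSym) → Vec (Fin size) (funAr f) → Fin size
    constI : ConstSym → Fin size

open FinStructure public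

Carrier : {L : Language} → FinStructure L → Set
Carrier A = Fin (size A)

record Epi {L : Language} (A B : FinStructure L) : Set where
  open Language L
  field
    map      : Carrier A → Carrier B
    surj     : (b : Carrier B) → ∃ λ a → map a ≡ b
    relImg   : (r : RelSym) (bs : Vec (Carrier B) (relAr r)) →
               (relI B r bs → ∃ λ as → relI A r as × Vec.map map as ≡ bs)
               × ((∃ λ as → relI A r as × Vec.map map as ≡ bs) → relI B r bs)
    funHom   : (f : FunSym) (as : Vec (Carrier A) (funAr f)) →
               funI B f (Vec.map map as) ≡ map (funI A f as)
    constHom : (c : ConstSym) → map (constI A c) ≡ constI B c

open Epi public

-- π_n^{d+n} : D_{d+n} → D_n, the composite π_n ∘ ⋯ ∘ π_{d+n-1}
-- (π_n^n = id).
comp : {L : Language} (D : ℕ → FinStructure L)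
       (π : (n : ℕ) → Epi (D (suc n)) (D n)) →
       (n d : ℕ) → Carrier (D (d + n)) → Carrier (D n)
comp D π n zero x = x
comp D π n (suc d) x = comp D π n d (map (π (d + n)) x)

-- (D_n, π_n) is a fundamental sequence for the class given as the range of
-- the family F : I → FinStructure L.
record IsFundamentalSequence {L : Language} {I : Set}
         (F : I → FinStructure L)
         (D : ℕ → FinStructure L)
         (π : (n : ℕ) → Epi (D (suc n)) (D n)) : Set₁ where
  field
    inClass : (n : ℕ) → Σ I λ i → F i ≡ D n
    cofinal : (i : I) → Σ ℕ λ n → Epi (D n) (F i)
    -- (ii)  (m ≥ n is written m = d + n)
    amalg   : (n : ℕ) (e f : I) (φ₁ : Epi (F f) (F e)) (φ₂ : Epi (D n) (F e)) →
              Σ ℕ λ d → Σ (Epi (D (d + n)) (F f)) λ ψ →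
                (x : Carrier (D (d + n))) →
                  map φ₁ (map ψ x) ≡ map φ₂ (comp D π n d x)

module Submission where

-- Epimorphisms of L-structures contain the identities and are
-- closed under composition, so every composite π_n^{d+n} of the one-step
-- maps of a sequence is itself an epimorphism D_{d+n} → D_n, and its
-- underlying map is the function 'comp'.  Call a sequence rigid when any two
-- epimorphisms D_m → D_n with n ≤ m agree pointwise.  In a rigid sequence,
-- to amalgamate φ₁ : D_f → D_e and φ₂ : D_n → D_e it suffices to pick some
-- m ≥ n, e and any epimorphism ψ : D_m → D_f: both φ₁ ∘ ψ and φ₂ ∘ π_n^m are
-- epimorphisms D_m → D_e, hence equal.  Under the hypothesis of the theorem
-- the given maps π_n^m supply these ψ, each D_n is trivially in the class
-- {D_n}, and D_n → D_n is witnessed by π_n^n, which gives (i).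

open import Defs
open import Data.Nat using (ℕ; suc; zero; _≤_; _+_)
open import Data.Nat.Properties using (n≤1+n; ≤-refl; m≤m+n; m≤n+m; ≤-trans)
open import Relation.Binary.PropositionalEquality
  using (_≡_; refl; sym; trans; cong; subst; module ≡-Reasoning)
open import Data.Product using (Σ; _×_; _,_; ∃; proj₁; proj₂)
import Data.Vec as Vec
open import Data.Vec.Properties using (map-id; map-∘)
open import Function using (id; _∘_)

idEpi : {L : Language} (A : FinStructure L) → Epi A A
idEpi A = record
  { map      = id
  ; surj     = λ b → b , refl
  ; relImg   = λ r bs → (λ h → bs , h , map-id bs)
                      , (λ { (as , h , eq) → subst (relI A r) (trans (sym (map-id as)) eq) h })
  ; funHom   = λ f as → cong (funI A f) (map-id as)
  ; constHom = λ c → refl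
  }

_∘ᴱ_ : {L : Language} {A B C : FinStructure L} → Epi B C → Epi A B → Epi A C
_∘ᴱ_ {L} {A} {B} {C} g f = record
  { map      = map g ∘ map f
  ; surj     = surjective
  ; relImg   = λ r cs → reflects r cs , preserves r cs
  ; funHom   = homomorphic
  ; constHom = λ c → trans (cong (map g) (constHom f c)) (constHom g c)
  }
  where
  open Language L

  surjective : (c : Carrier C) → ∃ λ a → map g (map f a) ≡ c
  surjective c with surj g c
  ... | b , gb≡c with surj f b
  ...   | a , fa≡b = a , trans (cong (map g) fa≡b) gb≡c

  reflects : (r : RelSym) (cs : Vec.Vec (Carrier C) (relAr r)) → relI C r cs →
             ∃ λ as → relI A r as × Vec.map (map g ∘ map f) as ≡ cs
  reflects r cs h with proj₁ (relImg g r cs) h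
  ... | bs , hb , gbs≡cs with proj₁ (relImg f r bs) hb
  ...   | as , ha , fas≡bs =
          as , ha , trans (map-∘ (map g) (map f) as)
                          (trans (cong (Vec.map (map g)) fas≡bs) gbs≡cs)

  preserves : (r : RelSym) (cs : Vec.Vec (Carrier C) (relAr r)) →
              (∃ λ as → relI A r as × Vec.map (map g ∘ map f) as ≡ cs) → relI C r cs
  preserves r cs (as , ha , eq) =
    proj₂ (relImg g r cs)
      ( Vec.map (map f) as
      , proj₂ (relImg f r _) (as , ha , refl)
      , trans (sym (map-∘ (map g) (map f) as)) eq )

  homomorphic : (h : FunSym) (as : Vec.Vec (Carrier A) (funAr h)) →
                funI C h (Vec.map (map g ∘ map f) as) ≡ map g (map f (funI A h as))
  homomorphic h as = begin
    funI C h (Vec.map (map g ∘ map f) as)          ≡⟨ cong (funI C h) (map-∘ (map g) (map f) as) ⟩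
    funI C h (Vec.map (map g) (Vec.map (map f) as)) ≡⟨ funHom g h (Vec.map (map f) as) ⟩
    map g (funI B h (Vec.map (map f) as))           ≡⟨ cong (map g) (funHom f h as) ⟩
    map g (map f (funI A h as))                     ∎
    where open ≡-Reasoning

compEpi : {L : Language} (D : ℕ → FinStructure L)
          (π : (n : ℕ) → Epi (D (suc n)) (D n)) →
          (n d : ℕ) → Epi (D (d + n)) (D n)
compEpi D π n zero    = idEpi (D n)
compEpi D π n (suc d) = compEpi D π n d ∘ᴱ π (d + n)

compEpi-map : {L : Language} (D : ℕ → FinStructure L)
              (π : (n : ℕ) → Epi (D (suc n)) (D n)) (n d : ℕ)
              (x : Carrier (D (d + n))) → map (compEpi D π n d) x ≡ comp D π n d x
compEpi-map D π n zero    x = refl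
compEpi-map D π n (suc d) x = compEpi-map D π n d (map (π (d + n)) x)

Rigid : {L : Language} → (ℕ → FinStructure L) → Set
Rigid D = (n m : ℕ) → n ≤ m → (e₁ e₂ : Epi (D m) (D n)) (x : Carrier (D m)) →
          map e₁ x ≡ map e₂ x

-- Amalgamation in a rigid sequence: if e ≤ d + n, any epimorphism
-- ψ : D_{d+n} → D_f completes the square φ₁ ∘ ψ = φ₂ ∘ π_n^{d+n}, because
-- both sides are epimorphisms D_{d+n} → D_e.
rigid-amalgamate : {L : Language} (D : ℕ → FinStructure L) → Rigid D →
                   (π : (n : ℕ) → Epi (D (suc n)) (D n)) (n d e f : ℕ) → e ≤ d + n →
                   (φ₁ : Epi (D f) (D e)) (φ₂ : Epi (D n) (D e))
                   (ψ : Epi (D (d + n)) (D f)) (x : Carrier (D (d + n))) →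
                   map φ₁ (map ψ x) ≡ map φ₂ (comp D π n d x)
rigid-amalgamate D rigid π n d e f e≤m φ₁ φ₂ ψ x = begin
  map (φ₁ ∘ᴱ ψ) x                    ≡⟨ rigid e (d + n) e≤m (φ₁ ∘ᴱ ψ) (φ₂ ∘ᴱ compEpi D π n d) x ⟩
  map φ₂ (map (compEpi D π n d) x)  ≡⟨ cong (map φ₂) (compEpi-map D π n d x) ⟩
  map φ₂ (comp D π n d x)            ∎
  where open ≡-Reasoning

-- Lemma 3.3.  The uniqueness hypothesis says precisely that D is rigid.  For
-- (ii) take m = (e + f) + n, which dominates both e and f, and ψ = π_f^m.
lemma3p3 : (L : Language) (D : ℕ → FinStructure L)
           (π : (n m : ℕ) → n ≤ m → Epi (D m) (D n)) →
           ((n m : ℕ) (p : n ≤ m) (e₁ e₂ : Epi (D m) (D n)) →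
              (x : Carrier (D m)) → map e₁ x ≡ map e₂ x) →
           IsFundamentalSequence D D (λ n → π n (suc n) (n≤1+n n))
lemma3p3 L D π unique = record
  { inClass = λ n → n , refl
  ; cofinal = λ i → i , π i i ≤-refl
  ; amalg   = amalgamate
  }
  where
  step : (n : ℕ) → Epi (D (suc n)) (D n)
  step n = π n (suc n) (n≤1+n n)

  amalgamate : (n e f : ℕ) (φ₁ : Epi (D f) (D e)) (φ₂ : Epi (D n) (D e)) →
               Σ ℕ λ d → Σ (Epi (D (d + n)) (D f)) λ ψ →
                 (x : Carrier (D (d + n))) → map φ₁ (map ψ x) ≡ map φ₂ (comp D step n d x)
  amalgamate n e f φ₁ φ₂ =
    e + f , ψ , rigid-amalgamate D unique step n (e + f) e f e≤m φ₁ φ₂ ψ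
    where
    e≤m : e ≤ e + f + n
    e≤m = ≤-trans (m≤m+n e f) (m≤m+n (e + f) n)

    ψ : Epi (D (e + f + n)) (D f)
    ψ = π f (e + f + n) (≤-trans (m≤n+m f e) (m≤m+n (e + f) n))
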